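{- Let $K$ be a number field with ring of integers $\mathcal{O}_K$ and let $Q$ be a positive integer. For $i=1,\dots,u$ let $f_i(z)=\sum_{n=0}^\infty a_i(n)q^n\in M_{k_i}(\Gamma_0(N_i),\chi_i)$ (integer weight $k_i$) and for $j=1,\dots,v$ let $g_j(z)=\sum_{m=0}^\infty b_j(m)q^m\in M_{\lambda_j+\frac12}(\Gamma_0(4M_j),\chi_j)$ (half-integral weight, $\lambda_j\in\mathbb{Z}$), all with coefficients in $\mathcal{O}_K$. Suppose that for primes $p_1,\dots,p_u,\ell_1,\dots,\ell_v$, all distinct, with $p_i\nmid N_i$ and $\ell_j\nmid 4M_j$, we have \[f_i(z)\mid T_{p_i,k_i,\chi_i}\equiv 0\pmod Q\quad\text{and}\quad g_j(z)\mid T(\ell_j^2,\lambda_j,\chi_j)\equiv 0\pmod Q\] for all $i$ and $j$. Then, writing $L=\prod_{i}p_i^{2r_i+1}\prod_j \ell_j^{4s_j+3}$ with $r_i,s_j$ arbitrary nonnegative integers, \[a_1(Ln)\equiv\cdots\equiv a_u(Ln)\equiv b_1(Ln)\equiv\cdots\equiv b_v(Ln)\equiv 0\pmod Q\] for every integer $n$ with $\gcd(p_1\cdots p_u\ell_1\cdots\ell_v,n)=1$.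
   Context: $q=e^{2\pi i z}$. $M_k(\Gamma_0(N),\chi)$ denotes holomorphic modular forms of weight $k$ and Nebentypus $\chi$ on $\Gamma_0(N)$ (for half-integral weight $\lambda+\frac12$ on $\Gamma_0(4N)$, the transformation law is $g(\frac{az+b}{cz+d})=\chi(d)(\frac{c}{d})^{2\lambda+1}\varepsilon_d^{ -2\lambda-1}(cz+d)^{\lambda+\frac12}g(z)$ with $\varepsilon_d=1$ or $i$ according as $d\equiv1$ or $3\pmod4$). For a prime $p\nmid N$ the integer weight Hecke operator acts by $f\mid T_{p,k,\chi}=\sum_n\big(a(pn)+\chi(p)p^{k-1}a(n/p)\big)q^n$, with $a(n/p)=0$ if $p\nmid n$. For a prime $\ell\nmid 4N$ the half-integral weight Hecke operator acts by $g\mid T(\ell^2,\lambda,\chi)=\sum_m\big(b(\ell^2m)+\chi^*(\ell)\left(\frac{m}{\ell}\right)\ell^{\lambda-1}b(m)+\chi^*(\ell^2)\ell^{2\lambda-1}b(m/\ell^2)\big)q^m$, where $\chi^*(m)=\left(\frac{(-1)^\lambda}{m}\right)\chi(m)$ and $b(m/\ell^2)=0$ if $\ell^2\nmid m$. A congruence of $q$-series modulo $Q$ means coefficientwise congruence in $\mathcal{O}_K$. -}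

module Defs where

open import Level using (Level)
open import Data.Nat using (ℕ; zero; suc; _*_; _∸_; _^_; ∣_-_∣)
open import Data.Nat.Divisibility using (_∣_; _∣?_; quotient)

open import Data.Bool using (Bool; true; false; if_then_else_)
open import Data.Fin using (Fin; zero; suc)
open import Data.List using (upTo)
open import Data.Bool.ListAction using (any)
open import Data.Product using (∃)
open import Relation.Nullary using (Dec; yes; no; does)
open import Algebra.Bundles using (CommutativeRing; Semiring)
import Algebra.Definitions.RawSemiring as RS

prodFin : ∀ {n} → (Fin n → ℕ) → ℕ
prodFin {zero} f = 1
prodFin {suc n} f = f zero * prodFin (λ i → f (suc i))

isEven : ℕ → Bool
isEven zero = true
isEven (suc zero) = false
isEven (suc (suc n)) = isEven n

isQR : ℕ → ℕ → Bool
isQR l m = any (λ x → does (l ∣? ∣ x * x - m ∣)) (upTo l)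

module _ {c r : Level} (R : CommutativeRing c r) where
  open CommutativeRing R renaming (_*_ to _*ᴿ_; _+_ to _+ᴿ_)
  open RS (Semiring.rawSemiring semiring) using (_×_)

  fromℕ : ℕ → Carrier
  fromℕ n = n × 1#

  _≡0[mod_] : Carrier → ℕ → Set (c Level.⊔ r)
  x ≡0[mod Q ] = ∃ λ y → x ≈ fromℕ Q *ᴿ y

  leg : ℕ → ℕ → Carrier
  leg l m with l ∣? m
  ... | yes _ = 0#
  ... | no _ = if isQR l m then 1# else - 1#

  -- ((-1)^lam / l) for an odd prime l
  legSign : ℕ → ℕ → Carrier
  legSign l lam = if isEven lam then 1# else leg l (l ∸ 1)

  quotOr0 : (ℕ → Carrier) → ℕ → ℕ → Carrier
  quotOr0 a d n with d ∣? n
  ... | yes dv = a (quotient dv)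
  ... | no _ = 0#

  -- n-th coefficient of f | T_{p,k,χ}
  heckeInt : ℕ → ℕ → (ℕ → Carrier) → (ℕ → Carrier) → ℕ → Carrier
  heckeInt p k χ a n = a (p * n) +ᴿ χ p *ᴿ fromℕ (p ^ (k ∸ 1)) *ᴿ quotOr0 a p n

  chiStar : ℕ → ℕ → (ℕ → Carrier) → Carrier
  chiStar l lam χ = legSign l lam *ᴿ χ l

  -- χ*(l²) = ((-1)^lam / l²) χ(l²), with the Jacobi symbol (·/l²) = (·/l)²
  chiStar2 : ℕ → ℕ → (ℕ → Carrier) → Carrier
  chiStar2 l lam χ = legSign l lam *ᴿ legSign l lam *ᴿ χ (l * l)

  -- m-th coefficient of g | T(l², lam, χ)
  heckeHalf : ℕ → ℕ → (ℕ → Carrier) → (ℕ → Carrier) → ℕ → Carrier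
  heckeHalf l lam χ b m =
    b (l * l * m)
    +ᴿ chiStar l lam χ *ᴿ leg l m *ᴿ fromℕ (l ^ (lam ∸ 1)) *ᴿ b m
    +ᴿ chiStar2 l lam χ *ᴿ fromℕ (l ^ (2 * lam ∸ 1)) *ᴿ quotOr0 b (l * l) m

{-# OPTIONS --safe #-}
module Submission where

-- Modulo Q the Hecke relation reads a(p²n) ≡ -χ(p)p^(k-1) a(n), so a(p n) ≡ 0 whenever p ∤ n, and
-- this vanishing propagates from p^e n to p^(e+2) n.  For half-integral weight, evaluating the
-- relation at l m with l ∤ m kills both lower terms, giving b(l³m) ≡ 0; at arguments divisible by l
-- the Legendre symbol vanishes, so vanishing propagates from l^e m to l^(e+4) m.  Since the primes
-- are distinct and coprime to n, L n = p^(2r+1) m (resp. l^(4s+3) m) with m prime to p (resp. l).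

open import Defs
open import Level using (Level; _⊔_)
open import Data.Nat using (ℕ; zero; suc; _*_; _+_; _^_; _≤_; NonZero)
open import Data.Nat.Properties using (*-comm; *-suc; *-zeroʳ; +-assoc; +-suc; *-identityʳ; *-cancelʳ-≡; m*n≢0)
open import Data.Nat.Divisibility using (_∣_; divides; _∣?_; ∣-refl; ∣1⇒≡1; ∣m⇒∣m*n; ∣n⇒∣m*n; m∣m*n; *-cancelˡ-∣)
open import Data.Nat.Primality using (Prime; euclidsLemma; ¬prime[1]; prime⇒nonZero; prime⇒irreducible)
open import Data.Nat.Coprimality using (Coprime)
open import Data.Nat.Tactic.RingSolver using (solve-∀)
open import Data.Fin using (Fin; zero; suc)
open import Data.Fin.Properties using (suc-injective)
open import Data.Sum using ([_,_]; inj₁; inj₂)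
open import Data.Sum.Properties using (inj₁-injective; inj₂-injective)
open import Data.Product using (_×_; ∃; _,_)
open import Function using (case_of_)
open import Data.Empty using (⊥-elim)
open import Relation.Nullary using (¬_; yes; no)
open import Relation.Binary.PropositionalEquality using (_≡_; _≢_; refl; sym; trans; cong; subst)
open import Function.Definitions using (Injective)
open import Algebra.Bundles using (CommutativeRing)
import Algebra.Properties.Ring as RingProperties
import Algebra.Properties.CommutativeSemigroup as CommutativeSemigroupProperties
import Relation.Binary.Reasoning.Setoid as SetoidReasoning

iterate-+ : ∀ {ℓ} {P : ℕ → Set ℓ} k {e} → (∀ e → P e → P (k + e)) → P e → ∀ r → P (k * r + e)
iterate-+ {P = P} k {e} step pe zero = subst P (cong (_+ e) (sym (*-zeroʳ k))) pe
iterate-+ {P = P} k {e} step pe (suc r) =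
  subst P (trans (sym (+-assoc k (k * r) e)) (cong (_+ e) (sym (*-suc k r))))
    (step _ (iterate-+ k step pe r))

prime∤1 : ∀ {q} → Prime q → ¬ q ∣ 1
prime∤1 pq q∣1 = ¬prime[1] (subst Prime (∣1⇒≡1 q∣1) pq)

prime∤* : ∀ {q x y} → Prime q → ¬ q ∣ x → ¬ q ∣ y → ¬ q ∣ x * y
prime∤* {x = x} {y} pq q∤x q∤y q∣xy with euclidsLemma x y pq q∣xy
... | inj₁ q∣x = q∤x q∣x
... | inj₂ q∣y = q∤y q∣y

prime∤^ : ∀ {q x} → Prime q → ¬ q ∣ x → ∀ e → ¬ q ∣ x ^ e
prime∤^ pq q∤x zero = prime∤1 pq
prime∤^ pq q∤x (suc e) = prime∤* pq q∤x (prime∤^ pq q∤x e)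

prime∤prime : ∀ {q r} → Prime q → Prime r → q ≢ r → ¬ q ∣ r
prime∤prime pq pr q≢r q∣r with prime⇒irreducible pr q∣r
... | inj₁ q≡1 = ¬prime[1] (subst Prime q≡1 pq)
... | inj₂ q≡r = q≢r q≡r

prime∤coprime : ∀ {q m n} → Prime q → q ∣ m → Coprime m n → ¬ q ∣ n
prime∤coprime {q} pq q∣m cop q∣n = prime∤1 pq (subst (q ∣_) (cop (q∣m , q∣n)) ∣-refl)

∣prodFin : ∀ {u} (f : Fin u → ℕ) i → f i ∣ prodFin f
∣prodFin f zero = m∣m*n _
∣prodFin f (suc i) = ∣n⇒∣m*n (f zero) (∣prodFin (λ j → f (suc j)) i)

prime∤prodFin : ∀ {u q} (f : Fin u → ℕ) → Prime q → (∀ j → ¬ q ∣ f j) → ¬ q ∣ prodFin f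
prime∤prodFin {zero} f pq q∤f = prime∤1 pq
prime∤prodFin {suc u} f pq q∤f =
  prime∤* pq (q∤f zero) (prime∤prodFin (λ j → f (suc j)) pq (λ j → q∤f (suc j)))

prodFin-factor : ∀ {u q} (f : Fin u → ℕ) i → Prime q → (∀ j → j ≢ i → ¬ q ∣ f j) →
  ∃ λ m → prodFin f ≡ f i * m × ¬ q ∣ m
prodFin-factor f zero pq q∤f =
  _ , refl , prime∤prodFin (λ j → f (suc j)) pq (λ j → q∤f (suc j) (λ ()))
prodFin-factor f (suc i) pq q∤f
  with prodFin-factor (λ j → f (suc j)) i pq (λ j j≢i → q∤f (suc j) (λ e → j≢i (suc-injective e)))
... | m , eq , q∤m =
  f zero * m , trans (cong (f zero *_) eq) (swap (f zero) (f (suc i)) m) , prime∤* pq (q∤f zero (λ ())) q∤m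
  where
  swap : ∀ x y z → x * (y * z) ≡ y * (x * z)
  swap = solve-∀

prodFin-^-cofactor : ∀ {u} (q e : Fin u → ℕ) i {B n} → Prime (q i) →
  (∀ j → j ≢ i → ¬ q i ∣ q j) → ¬ q i ∣ B → ¬ q i ∣ n →
  ∃ λ m → prodFin (λ j → q j ^ e j) * B * n ≡ q i ^ e i * m × ¬ q i ∣ m
prodFin-^-cofactor q e i {B} {n} pq q∤q q∤B q∤n
  with prodFin-factor (λ j → q j ^ e j) i pq (λ j j≢i → prime∤^ pq (q∤q j j≢i) (e j))
... | m , eq , q∤m =
  m * (B * n) , trans (cong (λ x → x * B * n) eq) (regroup (q i ^ e i) m B n) ,
  prime∤* pq q∤m (prime∤* pq q∤B q∤n)
  where
  regroup : ∀ x y z w → x * y * z * w ≡ x * (y * (z * w))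
  regroup = solve-∀

module HeckeCongruences {c r : Level} (R : CommutativeRing c r) (Q : ℕ) where
  open CommutativeRing R
    using (Carrier; _≈_; 0#; -_; setoid; ring; *-commutativeSemigroup; *-congˡ; zeroʳ; distribˡ;
           +-identityʳ; +-congˡ; +-cong; -‿inverseʳ; -‿cong)
    renaming (_*_ to _*ᴿ_; _+_ to _+ᴿ_; *-comm to *ᴿ-comm; +-assoc to +ᴿ-assoc; sym to ≈-sym; trans to ≈-trans)
  open RingProperties ring using (-‿distribʳ-*)
  open CommutativeSemigroupProperties *-commutativeSemigroup using (x∙yz≈y∙xz)
  open SetoidReasoning setoid

  Q∣_ : Carrier → Set (c ⊔ r)
  Q∣ x = _≡0[mod_] R x Q

  Q∣0 : Q∣ 0#
  Q∣0 = 0# , ≈-sym (zeroʳ _)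

  Q∣-≡0 : ∀ {x} → x ≡ 0# → Q∣ x
  Q∣-≡0 refl = Q∣0

  Q∣-*ˡ : ∀ x {y} → Q∣ y → Q∣ (x *ᴿ y)
  Q∣-*ˡ x {y} (z , y≈Qz) = x *ᴿ z , (begin
    x *ᴿ y                  ≈⟨ *-congˡ y≈Qz ⟩
    x *ᴿ (fromℕ R Q *ᴿ z)   ≈⟨ x∙yz≈y∙xz x _ z ⟩
    fromℕ R Q *ᴿ (x *ᴿ z)   ∎)

  Q∣-resp-≈ : ∀ {x y} → x ≈ y → Q∣ x → Q∣ y
  Q∣-resp-≈ x≈y (z , x≈Qz) = z , ≈-trans (≈-sym x≈y) x≈Qz

  Q∣-*ʳ : ∀ x {y} → Q∣ y → Q∣ (y *ᴿ x)
  Q∣-*ʳ x {y} Q∣y = Q∣-resp-≈ (*ᴿ-comm x y) (Q∣-*ˡ x Q∣y)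

  Q∣-+-cancelʳ : ∀ {x y} → Q∣ (x +ᴿ y) → Q∣ y → Q∣ x
  Q∣-+-cancelʳ {x} {y} (z , x+y≈Qz) (w , y≈Qw) = z +ᴿ - w , (begin
    x                                     ≈⟨ ≈-sym (+-identityʳ x) ⟩
    x +ᴿ 0#                               ≈⟨ +-congˡ (≈-sym (-‿inverseʳ y)) ⟩
    x +ᴿ (y +ᴿ - y)                       ≈⟨ ≈-sym (+ᴿ-assoc x y (- y)) ⟩
    (x +ᴿ y) +ᴿ - y                       ≈⟨ +-cong x+y≈Qz (-‿cong y≈Qw) ⟩
    fromℕ R Q *ᴿ z +ᴿ - (fromℕ R Q *ᴿ w)  ≈⟨ +-congˡ (-‿distribʳ-* _ w) ⟩
    fromℕ R Q *ᴿ z +ᴿ fromℕ R Q *ᴿ - w    ≈⟨ ≈-sym (distribˡ _ z (- w)) ⟩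
    fromℕ R Q *ᴿ (z +ᴿ - w)               ∎)

  quotOr0-∤ : ∀ a {d n} → ¬ d ∣ n → quotOr0 R a d n ≡ 0#
  quotOr0-∤ a {d} {n} d∤n with d ∣? n
  ... | yes d∣n = ⊥-elim (d∤n d∣n)
  ... | no _ = refl

  quotOr0-* : ∀ a d n .{{_ : NonZero d}} → quotOr0 R a d (d * n) ≡ a n
  quotOr0-* a d n with d ∣? d * n
  ... | yes (divides q eq) = cong a (*-cancelʳ-≡ q n d (trans (sym eq) (*-comm d n)))
  ... | no d∤dn = ⊥-elim (d∤dn (m∣m*n n))

  leg-∣ : ∀ {l m} → l ∣ m → leg R l m ≡ 0#
  leg-∣ {l} {m} l∣m with l ∣? m
  ... | yes _ = refl
  ... | no l∤m = ⊥-elim (l∤m l∣m)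

  heckeInt-lead : ∀ p k χ a n → Q∣ heckeInt R p k χ a n → Q∣ quotOr0 R a p n → Q∣ a (p * n)
  heckeInt-lead p k χ a n Q∣T Q∣a[n/p] = Q∣-+-cancelʳ Q∣T (Q∣-*ˡ _ Q∣a[n/p])

  heckeHalf-lead : ∀ l lam χ b {m} → l ∣ m → Q∣ heckeHalf R l lam χ b m →
    Q∣ quotOr0 R b (l * l) m → Q∣ b (l * l * m)
  heckeHalf-lead l lam χ b l∣m Q∣T Q∣b[m/l²] =
    Q∣-+-cancelʳ (Q∣-+-cancelʳ Q∣T (Q∣-*ˡ _ Q∣b[m/l²]))
      (Q∣-*ʳ _ (Q∣-*ʳ _ (Q∣-*ˡ _ (Q∣-≡0 (leg-∣ l∣m)))))

  heckeInt-odd-powers : ∀ p k χ a .{{_ : NonZero p}} → (∀ n → Q∣ heckeInt R p k χ a n) →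
    ∀ {m} → ¬ p ∣ m → ∀ r → Q∣ a (p ^ (2 * r + 1) * m)
  heckeInt-odd-powers p k χ a T≡0 {m} p∤m = iterate-+ 2 step base
    where
    base : Q∣ a (p ^ 1 * m)
    base = subst (λ x → Q∣ a (x * m)) (sym (*-identityʳ p))
      (heckeInt-lead p k χ a m (T≡0 m) (Q∣-≡0 (quotOr0-∤ a p∤m)))
    step : ∀ e → Q∣ a (p ^ e * m) → Q∣ a (p ^ (2 + e) * m)
    step e Q∣a = subst (λ x → Q∣ a x) (regroup p (p ^ e) m)
      (heckeInt-lead p k χ a _ (T≡0 _) (subst Q∣_ (sym (quotOr0-* a p _)) Q∣a))
      where
      regroup : ∀ p y m → p * (p * (y * m)) ≡ p * (p * y) * m
      regroup = solve-∀

  heckeHalf-powers : ∀ l lam χ b .{{_ : NonZero l}} → (∀ m → Q∣ heckeHalf R l lam χ b m) →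
    ∀ {m} → ¬ l ∣ m → ∀ s → Q∣ b (l ^ (4 * s + 3) * m)
  heckeHalf-powers l lam χ b T≡0 {m} l∤m s =
    subst (λ e → Q∣ b (l ^ e * m)) (sym (+-suc (4 * s) 2)) (iterate-+ 4 step base s)
    where
    instance _ = m*n≢0 l l
    base : Q∣ b (l ^ 3 * m)
    base = subst (λ x → Q∣ b x) (regroup l m)
      (heckeHalf-lead l lam χ b (m∣m*n m) (T≡0 (l * m))
        (Q∣-≡0 (quotOr0-∤ b (λ l²∣lm → l∤m (*-cancelˡ-∣ l l²∣lm)))))
      where
      regroup : ∀ l m → l * l * (l * m) ≡ l * (l * (l * 1)) * m
      regroup = solve-∀
    -- Iterating on l ^ suc e keeps the argument divisible by l, so the Legendre term vanishes.
    step : ∀ e → Q∣ b (l ^ suc e * m) → Q∣ b (l ^ (4 + suc e) * m)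
    step e Q∣b = subst (λ x → Q∣ b x) (regroup l (l ^ e) m)
      (heckeHalf-lead l lam χ b (∣m⇒∣m*n _ (m∣m*n l)) (T≡0 _)
        (subst Q∣_ (sym (quotOr0-* b (l * l) _)) Q∣b))
      where
      regroup : ∀ l y m → l * l * (l * l * (l * y * m)) ≡ l * (l * (l * (l * (l * y)))) * m
      regroup = solve-∀

lemma4p1 : ∀ {c r} (R : CommutativeRing c r) (Q : ℕ) → 1 ≤ Q →
    (u v : ℕ) →
    (N k : Fin u → ℕ) (χ a : Fin u → ℕ → CommutativeRing.Carrier R) (p : Fin u → ℕ) →
    (M lam : Fin v → ℕ) (ψ b : Fin v → ℕ → CommutativeRing.Carrier R) (l : Fin v → ℕ) →
    (∀ i → 1 ≤ N i) → (∀ i → 1 ≤ k i) →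
    (∀ j → 1 ≤ M j) → (∀ j → 1 ≤ lam j) →
    (∀ i → Prime (p i)) → (∀ j → Prime (l j)) →
    Injective _≡_ _≡_ [ p , l ] →
    (∀ i → ¬ (p i ∣ N i)) → (∀ j → ¬ (l j ∣ 4 * M j)) →
    (∀ i n → _≡0[mod_] R (heckeInt R (p i) (k i) (χ i) (a i) n) Q) →
    (∀ j m → _≡0[mod_] R (heckeHalf R (l j) (lam j) (ψ j) (b j) m) Q) →
    (rr : Fin u → ℕ) (ss : Fin v → ℕ) (n : ℕ) →
    Coprime (prodFin p * prodFin l) n →
    let L = prodFin (λ i → p i ^ (2 * rr i + 1)) * prodFin (λ j → l j ^ (4 * ss j + 3)) in
    (∀ i → _≡0[mod_] R (a i (L * n)) Q) × (∀ j → _≡0[mod_] R (b j (L * n)) Q)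
lemma4p1 R Q _ u v N k χ a p M lam ψ b l _ _ _ _ p-prime l-prime distinct _ _ Ta≡0 Tb≡0 rr ss n coprime =
  a-vanishes , b-vanishes
  where
  open HeckeCongruences R Q
  er : Fin u → ℕ
  er i = 2 * rr i + 1
  es : Fin v → ℕ
  es j = 4 * ss j + 3
  Pu Pv : ℕ
  Pu = prodFin (λ i → p i ^ er i)
  Pv = prodFin (λ j → l j ^ es j)

  p∤p : ∀ i j → j ≢ i → ¬ p i ∣ p j
  p∤p i j j≢i = prime∤prime (p-prime i) (p-prime j) λ e → j≢i (sym (inj₁-injective (distinct {inj₁ i} {inj₁ j} e)))
  l∤l : ∀ j j′ → j′ ≢ j → ¬ l j ∣ l j′
  l∤l j j′ j′≢j = prime∤prime (l-prime j) (l-prime j′) λ e → j′≢j (sym (inj₂-injective (distinct {inj₂ j} {inj₂ j′} e)))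
  p∤l : ∀ i j → ¬ p i ∣ l j
  p∤l i j = prime∤prime (p-prime i) (l-prime j) λ e → case distinct {inj₁ i} {inj₂ j} e of λ ()
  l∤p : ∀ j i → ¬ l j ∣ p i
  l∤p j i = prime∤prime (l-prime j) (p-prime i) λ e → case distinct {inj₂ j} {inj₁ i} e of λ ()

  a-vanishes : ∀ i → Q∣ a i (Pu * Pv * n)
  a-vanishes i
    with prodFin-^-cofactor p er i (p-prime i) (p∤p i)
           (prime∤prodFin _ (p-prime i) λ j → prime∤^ (p-prime i) (p∤l i j) (es j))
           (prime∤coprime (p-prime i) (∣m⇒∣m*n (prodFin l) (∣prodFin p i)) coprime)
  ... | m , Pu*Pv*n≡ , p∤m = subst (λ x → Q∣ a i x) (sym Pu*Pv*n≡)
    (heckeInt-odd-powers (p i) (k i) (χ i) (a i) {{prime⇒nonZero (p-prime i)}} (Ta≡0 i) p∤m (rr i))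

  b-vanishes : ∀ j → Q∣ b j (Pu * Pv * n)
  b-vanishes j
    with prodFin-^-cofactor l es j (l-prime j) (l∤l j)
           (prime∤prodFin _ (l-prime j) λ i → prime∤^ (l-prime j) (l∤p j i) (er i))
           (prime∤coprime (l-prime j) (∣n⇒∣m*n (prodFin p) (∣prodFin l j)) coprime)
  ... | m , Pv*Pu*n≡ , l∤m = subst (λ x → Q∣ b j x) (sym (trans (cong (_* n) (*-comm Pu Pv)) Pv*Pu*n≡))
    (heckeHalf-powers (l j) (lam j) (ψ j) (b j) {{prime⇒nonZero (l-prime j)}} (Tb≡0 j) l∤m (ss j))
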